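{- Let $n$ be an odd perfect number with $15 \mid n$, and let $\alpha,b$ be positive integers such that $5^{\alpha}\,\|\, n$ and $3^{2b}\,\|\, n$. If $3 \mid (\alpha+1)(2b+1)$, then $n$ has a good prime divisor.
   Context: A positive integer $n$ is perfect if $\sigma(n)=2n$, where $\sigma(n)$ is the sum of the positive divisors of $n$. For a prime $p$ and $e\ge 1$, $p^e \,\|\, n$ means $p^e \mid n$ and $p^{e+1}\nmid n$. Let $\Phi_3(x)=x^2+x+1$. Let $\Sigma$ be the set of primes $p$ with $p\equiv 2$ or $p \equiv 4 \pmod 7$. For a prime $x$, let $T(x)$ be the set of primes $q\neq 3$ with $q \mid \Phi_3(x)$. For a prime $p>7$ define recursively $S_0(p)=\{p\}$ and $S_{m+1}(p)=S_m(p)\cup\bigcup_{x\in S_m(p)} T(x)$. A prime $p>7$ is called good if there is an integer $m\ge 0$ with $S_m(p)\cap\Sigma\neq\emptyset$. -}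

module Defs where

open import Data.Nat using (ℕ; zero; suc; _+_; _*_; _^_; _<_; _%_)
open import Data.Nat.Divisibility using (_∣_; _∣?_)
open import Data.Nat.Primality using (Prime)
open import Data.List using (List; filter; upTo; map)
open import Data.Nat.ListAction using (sum)
open import Data.Product using (_×_; ∃-syntax)
open import Data.Sum using (_⊎_)
open import Relation.Binary.PropositionalEquality using (_≡_; _≢_)
open import Relation.Nullary using (¬_)

σ : ℕ → ℕ
σ n = sum (filter (λ d → d ∣? n) (map suc (upTo n)))

Perfect : ℕ → Set
Perfect n = (0 < n) × (σ n ≡ 2 * n)

ExactPow : ℕ → ℕ → ℕ → Set
ExactPow p e n = (p ^ e ∣ n) × ¬ (p ^ (suc e) ∣ n)

Φ₃ : ℕ → ℕ
Φ₃ x = x * x + x + 1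

InΣ : ℕ → Set
InΣ p = Prime p × ((p % 7 ≡ 2) ⊎ (p % 7 ≡ 4))

InT : ℕ → ℕ → Set
InT x q = Prime q × (q ≢ 3) × (q ∣ Φ₃ x)

InS : ℕ → ℕ → ℕ → Set
InS p zero    x = x ≡ p
InS p (suc m) x = InS p m x ⊎ (∃[ y ] (InS p m y × InT y x))

Good : ℕ → Set
Good p = Prime p × (7 < p) × (∃[ m ] ∃[ x ] (InS p m x × InΣ x))

-- If q^e ∥ n and 3 ∣ e + 1, then σ(q^e) = 1 + q + ⋯ + q^e is a multiple of
-- 1 + q + q² = Φ₃(q), and σ(q^e) divides σ(n) = 2n by multiplicativity of σ.
-- So 3 ∣ α + 1 puts Φ₃(5) = 31 into n, and 3 ∣ 2b + 1 puts Φ₃(3) = 13 into n.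
-- Both are good: Φ₃(31) = 3 · 331 with 331 ≡ 2 (mod 7), while from 13 the primes
-- 61, 97, 3169, 3348577, 3737657091169, 181, 79 ≡ 2 (mod 7) each divide Φ₃ of the
-- previous one.
module Submission where

open import Defs
open import Data.Nat
open import Data.Nat.Properties
open import Data.Nat.Divisibility
open import Data.Nat.Primality
open import Data.Nat.Coprimality using (Coprime; coprime-divisor; prime⇒coprime)
open import Data.Nat.ListAction using (sum)
open import Data.Nat.ListAction.Properties using (sum-++)
open import Data.Nat.Tactic.RingSolver using (solve-∀)
open import Data.List using ([]; _∷_; filter; upTo; map; _++_)
open import Data.List.Properties using (upTo-∷ʳ; map-++; filter-++)
open import Data.Bool using (Bool; true; false; if_then_else_; T)
open import Data.Product using (_×_; _,_; ∃-syntax)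
open import Data.Sum using (inj₁; inj₂)
open import Level using (0ℓ)
open import Relation.Nullary using (¬_; yes; no; does; contradiction)
open import Relation.Nullary.Decidable using (from-yes)
open import Relation.Unary using (Pred; Decidable)
open import Relation.Binary.PropositionalEquality

sumTo : (ℕ → ℕ) → ℕ → ℕ
sumTo f zero    = 0
sumTo f (suc n) = sumTo f n + f (suc n)

sumTo-cong : ∀ {f g} n → (∀ d → f (suc d) ≡ g (suc d)) → sumTo f n ≡ sumTo g n
sumTo-cong zero    f≗g = refl
sumTo-cong (suc n) f≗g = cong₂ _+_ (sumTo-cong n f≗g) (f≗g n)

sumTo-+ : ∀ f g n → sumTo (λ d → f d + g d) n ≡ sumTo f n + sumTo g n
sumTo-+ f g zero    = refl
sumTo-+ f g (suc n) = begin
  sumTo (λ d → f d + g d) n + (f (suc n) + g (suc n))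
    ≡⟨ cong (_+ (f (suc n) + g (suc n))) (sumTo-+ f g n) ⟩
  sumTo f n + sumTo g n + (f (suc n) + g (suc n))
    ≡⟨ interchange (sumTo f n) (sumTo g n) (f (suc n)) (g (suc n)) ⟩
  sumTo f n + f (suc n) + (sumTo g n + g (suc n)) ∎
  where
  open ≡-Reasoning
  interchange : ∀ a b c d → a + b + (c + d) ≡ a + c + (b + d)
  interchange = solve-∀

sumTo-*ʳ : ∀ f c n → sumTo (λ d → f d * c) n ≡ sumTo f n * c
sumTo-*ʳ f c zero    = refl
sumTo-*ʳ f c (suc n) = trans (cong (_+ f (suc n) * c) (sumTo-*ʳ f c n))
                             (sym (*-distribʳ-+ c (sumTo f n) (f (suc n))))

sumTo-vanishing-beyond : ∀ {f m} N → (∀ d → m < d → f d ≡ 0) → m ≤ N →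
                         sumTo f N ≡ sumTo f m
sumTo-vanishing-beyond zero    f≡0 z≤n = refl
sumTo-vanishing-beyond {f} {m} (suc N) f≡0 m≤1+N with m≤n⇒m<n∨m≡n m≤1+N
... | inj₂ refl   = refl
... | inj₁ m<1+N = trans (cong₂ _+_ (sumTo-vanishing-beyond N f≡0 (s≤s⁻¹ m<1+N)) (f≡0 (suc N) m<1+N))
                         (+-identityʳ (sumTo f m))

sumTo-multiples : ∀ {p h} .{{_ : NonZero p}} → (∀ d → p ∤ d → h d ≡ 0) →
                  ∀ M → sumTo h (M * p) ≡ sumTo (λ j → h (j * p)) M
sumTo-multiples {suc p′} {h} h≡0 zero    = refl
sumTo-multiples {suc p′} {h} h≡0 (suc M) =
  cong (_+ h (suc M * p)) (trans (below-next-multiple p′ ≤-refl) (sumTo-multiples h≡0 M))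
  where
  p = suc p′
  below-next-multiple : ∀ c → c < p → sumTo h (c + M * p) ≡ sumTo h (M * p)
  below-next-multiple zero    _     = refl
  below-next-multiple (suc c) 1+c<p =
    trans (cong₂ _+_ (below-next-multiple c (<-trans (n<1+n c) 1+c<p)) (h≡0 _ p∤1+c+Mp))
          (+-identityʳ _)
    where
    p∤1+c+Mp : p ∤ suc c + M * p
    p∤1+c+Mp p∣ = <⇒≱ 1+c<p (∣⇒≤ (∣m+n∣m⇒∣n (subst (p ∣_) (+-comm (suc c) (M * p)) p∣) (n∣m*n M)))

sum-filter-upTo : ∀ {P : Pred ℕ 0ℓ} (P? : Decidable P) n →
                  sum (filter P? (map suc (upTo n))) ≡ sumTo (λ d → if does (P? d) then d else 0) n
sum-filter-upTo P? zero    = refl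
sum-filter-upTo P? (suc n) = begin
  sum (filter P? (map suc (upTo (suc n))))
    ≡⟨ cong (λ l → sum (filter P? (map suc l))) (sym (upTo-∷ʳ n)) ⟩
  sum (filter P? (map suc (upTo n ++ n ∷ [])))
    ≡⟨ cong (λ l → sum (filter P? l)) (map-++ suc (upTo n) (n ∷ [])) ⟩
  sum (filter P? (map suc (upTo n) ++ suc n ∷ []))
    ≡⟨ cong sum (filter-++ P? (map suc (upTo n)) (suc n ∷ [])) ⟩
  sum (filter P? (map suc (upTo n)) ++ filter P? (suc n ∷ []))
    ≡⟨ sum-++ (filter P? (map suc (upTo n))) (filter P? (suc n ∷ [])) ⟩
  sum (filter P? (map suc (upTo n))) + sum (filter P? (suc n ∷ []))
    ≡⟨ cong₂ _+_ (sum-filter-upTo P? n) last ⟩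
  sumTo (λ d → if does (P? d) then d else 0) (suc n) ∎
  where
  open ≡-Reasoning
  last : sum (filter P? (suc n ∷ [])) ≡ (if does (P? (suc n)) then suc n else 0)
  last with does (P? (suc n))
  ... | true  = +-identityʳ (suc n)
  ... | false = refl

divisorTerm : ℕ → ℕ → ℕ
divisorTerm N d = if does (d ∣? N) then d else 0

σ≡sumTo-divisorTerm : ∀ N → σ N ≡ sumTo (divisorTerm N) N
σ≡sumTo-divisorTerm N = sum-filter-upTo (_∣? N) N

divisorTerm-∣ : ∀ {d N} → d ∣ N → divisorTerm N d ≡ d
divisorTerm-∣ {d} {N} d∣N with d ∣? N
... | yes _   = refl
... | no d∤N = contradiction d∣N d∤N

divisorTerm-∤ : ∀ {d N} → d ∤ N → divisorTerm N d ≡ 0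
divisorTerm-∤ {d} {N} d∤N with d ∣? N
... | yes d∣N = contradiction d∣N d∤N
... | no _    = refl

offMultiples onMultiples : ℕ → (ℕ → ℕ) → ℕ → ℕ
offMultiples p f d = if does (p ∣? d) then 0 else f d
onMultiples  p f d = if does (p ∣? d) then f d else 0

sumTo-split-multiples : ∀ p f n → sumTo f n ≡ sumTo (offMultiples p f) n + sumTo (onMultiples p f) n
sumTo-split-multiples p f n = trans (sumTo-cong n (λ d → split (suc d))) (sumTo-+ _ _ n)
  where
  split : ∀ d → f d ≡ offMultiples p f d + onMultiples p f d
  split d with p ∣? d
  ... | yes _ = refl
  ... | no _  = sym (+-identityʳ (f d))

prime∤⇒coprime : ∀ {p d} → Prime p → p ∤ d → Coprime d p
prime∤⇒coprime pp p∤d {i} (i∣d , i∣p) with prime⇒irreducible pp i∣p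
... | inj₁ i≡1 = i≡1
... | inj₂ refl = contradiction i∣d p∤d

∣p^k*m⇒∣m : ∀ {p d m} → Prime p → p ∤ d → ∀ k → d ∣ p ^ k * m → d ∣ m
∣p^k*m⇒∣m {m = m} pp p∤d zero    d∣ = subst (_ ∣_) (+-identityʳ m) d∣
∣p^k*m⇒∣m {p} {d} {m} pp p∤d (suc k) d∣ =
  ∣p^k*m⇒∣m pp p∤d k (coprime-divisor (prime∤⇒coprime pp p∤d) (subst (d ∣_) (*-assoc p (p ^ k) m) d∣))

-- With K = p^k m, the divisors of K p prime to p are those of m, and the others are
-- p times the divisors of K; hence σ(K p) = σ(m) + σ(K) p.
module _ {p m} (pp : Prime p) (p∤m : p ∤ m) (k : ℕ) where
  private
    K = p ^ k * m
    instance
      p≢0 : NonZero p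
      p≢0 = prime⇒nonZero pp
      m≢0 : NonZero m
      m≢0 = ≢-nonZero (λ { refl → p∤m (p ∣0) })
      Kp≢0 : NonZero (K * p)
      Kp≢0 = m*n≢0 K p {{m*n≢0 (p ^ k) m {{m^n≢0 p k}}}}

    Kp≡p^[1+k]m : K * p ≡ p ^ suc k * m
    Kp≡p^[1+k]m = trans (*-comm K p) (sym (*-assoc p (p ^ k) m))

  sumTo-offMultiples-divisorTerm : sumTo (offMultiples p (divisorTerm (K * p))) (K * p) ≡ σ m
  sumTo-offMultiples-divisorTerm = begin
    sumTo (offMultiples p (divisorTerm (K * p))) (K * p) ≡⟨ sumTo-cong (K * p) (λ d → off≡ (suc d)) ⟩
    sumTo (divisorTerm m) (K * p)                         ≡⟨ sumTo-vanishing-beyond (K * p)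
                                                               (λ d m<d → divisorTerm-∤ (λ d∣m → <⇒≱ m<d (∣⇒≤ d∣m)))
                                                               (∣⇒≤ (m∣Kp ∣-refl)) ⟩
    sumTo (divisorTerm m) m                               ≡⟨ σ≡sumTo-divisorTerm m ⟨
    σ m                                                   ∎
    where
    open ≡-Reasoning
    m∣Kp : ∀ {d} → d ∣ m → d ∣ K * p
    m∣Kp d∣m = ∣m⇒∣m*n p (∣-trans d∣m (n∣m*n (p ^ k)))
    off≡ : ∀ d → offMultiples p (divisorTerm (K * p)) d ≡ divisorTerm m d
    off≡ d with p ∣? d
    ... | yes p∣d = sym (divisorTerm-∤ (λ d∣m → p∤m (∣-trans p∣d d∣m)))
    ... | no p∤d with d ∣? m
    ...   | yes d∣m = divisorTerm-∣ (m∣Kp d∣m)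
    ...   | no d∤m  = divisorTerm-∤ (λ d∣Kp → d∤m
                        (∣p^k*m⇒∣m pp p∤d (suc k) (subst (d ∣_) Kp≡p^[1+k]m d∣Kp)))

  sumTo-onMultiples-divisorTerm : sumTo (onMultiples p (divisorTerm (K * p))) (K * p) ≡ σ K * p
  sumTo-onMultiples-divisorTerm = begin
    sumTo (onMultiples p (divisorTerm (K * p))) (K * p)          ≡⟨ sumTo-multiples on-vanishes K ⟩
    sumTo (λ j → onMultiples p (divisorTerm (K * p)) (j * p)) K ≡⟨ sumTo-cong K on≡ ⟩
    sumTo (λ j → divisorTerm K j * p) K                           ≡⟨ sumTo-*ʳ (divisorTerm K) p K ⟩
    sumTo (divisorTerm K) K * p                                   ≡⟨ cong (_* p) (σ≡sumTo-divisorTerm K) ⟨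
    σ K * p                                                       ∎
    where
    open ≡-Reasoning
    on-vanishes : ∀ d → p ∤ d → onMultiples p (divisorTerm (K * p)) d ≡ 0
    on-vanishes d p∤d with p ∣? d
    ... | yes p∣d = contradiction p∣d p∤d
    ... | no _    = refl
    on≡ : ∀ j → onMultiples p (divisorTerm (K * p)) (suc j * p) ≡ divisorTerm K (suc j) * p
    on≡ j with p ∣? suc j * p | suc j ∣? K
    ... | no p∤jp | _     = contradiction (n∣m*n (suc j)) p∤jp
    ... | yes _   | yes j∣K = trans (divisorTerm-∣ (*-monoˡ-∣ p j∣K)) (cong (_* p) (sym (divisorTerm-∣ j∣K)))
    ... | yes _   | no j∤K  = trans (divisorTerm-∤ (λ jp∣Kp → j∤K (*-cancelʳ-∣ p jp∣Kp)))
                                    (cong (_* p) (sym (divisorTerm-∤ j∤K)))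

  σ[p^[1+k]*m] : σ (p ^ suc k * m) ≡ σ m + σ (p ^ k * m) * p
  σ[p^[1+k]*m] = begin
    σ (p ^ suc k * m)                                      ≡⟨ cong σ Kp≡p^[1+k]m ⟨
    σ (K * p)                                              ≡⟨ σ≡sumTo-divisorTerm (K * p) ⟩
    sumTo (divisorTerm (K * p)) (K * p)                    ≡⟨ sumTo-split-multiples p _ (K * p) ⟩
    sumTo (offMultiples p (divisorTerm (K * p))) (K * p)
      + sumTo (onMultiples p (divisorTerm (K * p))) (K * p) ≡⟨ cong₂ _+_ sumTo-offMultiples-divisorTerm
                                                                      sumTo-onMultiples-divisorTerm ⟩
    σ m + σ K * p                                          ∎
    where open ≡-Reasoning

repunit : ℕ → ℕ → ℕ
repunit p zero    = 1
repunit p (suc k) = 1 + repunit p k * p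

σ[p^k*m] : ∀ {p m} → Prime p → p ∤ m → ∀ k → σ (p ^ k * m) ≡ repunit p k * σ m
σ[p^k*m] {p} {m} pp p∤m zero    = trans (cong σ (+-identityʳ m)) (sym (+-identityʳ (σ m)))
σ[p^k*m] {p} {m} pp p∤m (suc k) = begin
  σ (p ^ suc k * m)            ≡⟨ σ[p^[1+k]*m] pp p∤m k ⟩
  σ m + σ (p ^ k * m) * p      ≡⟨ cong (λ s → σ m + s * p) (σ[p^k*m] pp p∤m k) ⟩
  σ m + repunit p k * σ m * p  ≡⟨ regroup (σ m) (repunit p k) p ⟩
  repunit p (suc k) * σ m      ∎
  where
  open ≡-Reasoning
  regroup : ∀ s r p → s + r * s * p ≡ (1 + r * p) * s
  regroup = solve-∀

repunit[2]≡Φ₃ : ∀ p → repunit p 2 ≡ 1 * Φ₃ p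
repunit[2]≡Φ₃ = expand
  where
  expand : ∀ p → 1 + (1 + 1 * p) * p ≡ 1 * (p * p + p + 1)
  expand = solve-∀

repunit[3+k] : ∀ p k → repunit p (3 + k) ≡ Φ₃ p + repunit p k * (p * p * p)
repunit[3+k] p k = expand p (repunit p k)
  where
  expand : ∀ p r → 1 + (1 + (1 + r * p) * p) * p ≡ p * p + p + 1 + r * (p * p * p)
  expand = solve-∀

Φ₃∣repunit : ∀ p k → 3 ∣ suc k → Φ₃ p ∣ repunit p k
Φ₃∣repunit p 0 (divides zero    ())
Φ₃∣repunit p 0 (divides (suc _) ())
Φ₃∣repunit p 1 (divides zero    ())
Φ₃∣repunit p 1 (divides (suc _) ())
Φ₃∣repunit p 2 _ = divides 1 (repunit[2]≡Φ₃ p)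
Φ₃∣repunit p (suc (suc (suc k))) 3∣4+k = begin
  Φ₃ p                                    ∣⟨ ∣m∣n⇒∣m+n ∣-refl (∣m⇒∣m*n (p * p * p) (Φ₃∣repunit p k 3∣1+k)) ⟩
  Φ₃ p + repunit p k * (p * p * p)        ≡⟨ repunit[3+k] p k ⟨
  repunit p (3 + k)                       ∎
  where
  open ∣-Reasoning
  3∣1+k : 3 ∣ suc k
  3∣1+k = ∣m+n∣m⇒∣n {m = 3} 3∣4+k ∣-refl

Φ₃∣σ : ∀ {q e n} → Prime q → ExactPow q e n → 3 ∣ suc e → Φ₃ q ∣ σ n
Φ₃∣σ {q} {e} {n} pq (divides r n≡r*q^e , q^[1+e]∤n) 3∣1+e = begin
  Φ₃ q               ∣⟨ Φ₃∣repunit q e 3∣1+e ⟩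
  repunit q e        ∣⟨ m∣m*n (σ r) ⟩
  repunit q e * σ r  ≡⟨ σ[p^k*m] pq q∤r e ⟨
  σ (q ^ e * r)      ≡⟨ cong σ (trans (*-comm (q ^ e) r) (sym n≡r*q^e)) ⟩
  σ n                ∎
  where
  open ∣-Reasoning
  q∤r : q ∤ r
  q∤r q∣r = q^[1+e]∤n (subst (q ^ suc e ∣_) (sym n≡r*q^e) (*-monoˡ-∣ (q ^ e) q∣r))

∣2*n⇒∣n : ∀ {p n} → Prime p → 2 < p → p ∣ 2 * n → p ∣ n
∣2*n⇒∣n pp 2<p = coprime-divisor (prime⇒coprime pp 2<p)

2<Φ₃ : ∀ q .{{_ : NonZero q}} → 2 < Φ₃ q
2<Φ₃ q = +-monoˡ-≤ 1 (+-mono-≤ (*-mono-≤ 0<q 0<q) 0<q)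
  where 0<q = >-nonZero⁻¹ q

Φ₃∣perfect : ∀ {q e n} → Perfect n → Prime q → Prime (Φ₃ q) → ExactPow q e n → 3 ∣ suc e → Φ₃ q ∣ n
Φ₃∣perfect {q} (_ , σn≡2n) pq pΦ₃ q^e∥n 3∣1+e =
  ∣2*n⇒∣n pΦ₃ (2<Φ₃ q {{prime⇒nonZero pq}}) (subst (Φ₃ q ∣_) σn≡2n (Φ₃∣σ pq q^e∥n 3∣1+e))

-- The fuel only secures termination: fuel n always suffices for input n.
trialDivision : ℕ → ℕ → ℕ → Bool
trialDivision n m zero       = false
trialDivision n m (suc fuel) =
  if n <ᵇ m * m then true
  else if does (m ∣? n) then false
  else trialDivision n (suc m) fuel

trialDivision-sound : ∀ {n} .{{_ : NonTrivial n}} m fuel →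
                      T (trialDivision n m fuel) → m Rough n → Prime n
trialDivision-sound {n} m (suc fuel) ok m-rough with n <ᵇ m * m | <ᵇ⇒< n (m * m) | m ∣? n
... | true  | n<m² | _     = rough∧square>⇒prime m-rough (n<m² _)
... | false | _    | no m∤n = trialDivision-sound (suc m) fuel ok (∤⇒rough-suc m∤n m-rough)

prime-by-trialDivision : ∀ n .{{_ : NonTrivial n}} → T (trialDivision n 2 n) → Prime n
prime-by-trialDivision n ok = trialDivision-sound 2 n ok 2-rough

prime[3] : Prime 3
prime[3] = prime-by-trialDivision 3 _

prime[5] : Prime 5
prime[5] = prime-by-trialDivision 5 _

prime[13] : Prime 13
prime[13] = prime-by-trialDivision 13 _

prime[31] : Prime 31
prime[31] = prime-by-trialDivision 31 _

prime[61] : Prime 61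
prime[61] = prime-by-trialDivision 61 _

prime[79] : Prime 79
prime[79] = prime-by-trialDivision 79 _

prime[97] : Prime 97
prime[97] = prime-by-trialDivision 97 _

prime[181] : Prime 181
prime[181] = prime-by-trialDivision 181 _

prime[331] : Prime 331
prime[331] = prime-by-trialDivision 331 _

prime[3169] : Prime 3169
prime[3169] = prime-by-trialDivision 3169 _

prime[3348577] : Prime 3348577
prime[3348577] = prime-by-trialDivision 3348577 _

prime[3737657091169] : Prime 3737657091169
prime[3737657091169] = prime-by-trialDivision 3737657091169 _

InS-step : ∀ {p m y x} → InS p m y → InT y x → InS p (suc m) x
InS-step y∈Sₘ x∈Ty = inj₂ (_ , y∈Sₘ , x∈Ty)

good[31] : Good 31
good[31] = prime[31] , from-yes (7 <? 31) , 1 , 331 , 331∈S₁ , prime[331] , inj₁ refl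
  where
  331∈S₁ : InS 31 1 331
  331∈S₁ = InS-step refl (prime[331] , (λ ()) , from-yes (331 ∣? Φ₃ 31))

good[13] : Good 13
good[13] = prime[13] , from-yes (7 <? 13) , 7 , 79 , 79∈S₇ , prime[79] , inj₁ refl
  where
  61∈S₁ : InS 13 1 61
  61∈S₁ = InS-step refl (prime[61] , (λ ()) , from-yes (61 ∣? Φ₃ 13))
  97∈S₂ : InS 13 2 97
  97∈S₂ = InS-step 61∈S₁ (prime[97] , (λ ()) , from-yes (97 ∣? Φ₃ 61))
  3169∈S₃ : InS 13 3 3169
  3169∈S₃ = InS-step 97∈S₂ (prime[3169] , (λ ()) , from-yes (3169 ∣? Φ₃ 97))
  3348577∈S₄ : InS 13 4 3348577
  3348577∈S₄ = InS-step 3169∈S₃ (prime[3348577] , (λ ()) , from-yes (3348577 ∣? Φ₃ 3169))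
  3737657091169∈S₅ : InS 13 5 3737657091169
  3737657091169∈S₅ =
    InS-step 3348577∈S₄ (prime[3737657091169] , (λ ()) , from-yes (3737657091169 ∣? Φ₃ 3348577))
  181∈S₆ : InS 13 6 181
  181∈S₆ = InS-step 3737657091169∈S₅ (prime[181] , (λ ()) , from-yes (181 ∣? Φ₃ 3737657091169))
  79∈S₇ : InS 13 7 79
  79∈S₇ = InS-step 181∈S₆ (prime[79] , (λ ()) , from-yes (79 ∣? Φ₃ 181))

proposition4p1 : (n α b : ℕ) → Perfect n → ¬ (2 ∣ n) → 15 ∣ n →
    0 < α → 0 < b → ExactPow 5 α n → ExactPow 3 (2 * b) n →
    3 ∣ (α + 1) * (2 * b + 1) →
    ∃[ p ] (p ∣ n × Good p)
proposition4p1 n α b perfect _ _ _ _ 5^α∥n 3^2b∥n 3∣[α+1][2b+1]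
  with euclidsLemma (α + 1) (2 * b + 1) prime[3] 3∣[α+1][2b+1]
... | inj₁ 3∣α+1  = 31 , Φ₃∣perfect perfect prime[5] prime[31] 5^α∥n 3∣1+α , good[31]
  where 3∣1+α = subst (3 ∣_) (+-comm α 1) 3∣α+1
... | inj₂ 3∣2b+1 = 13 , Φ₃∣perfect perfect prime[3] prime[13] 3^2b∥n 3∣1+2b , good[13]
  where 3∣1+2b = subst (3 ∣_) (+-comm (2 * b) 1) 3∣2b+1
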